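{- Let $G_1$ and $G_2$ be two graphs, and let $\Gamma'_1,\ldots,\Gamma'_{t+t'-q}$ be the subgraphs of $G_1+G_2$ defined in the context. Then $$D'(G_1+G_2)\leq\max\{D'(\Gamma'_1),\ldots,D'(\Gamma'_{t+t'-q})\}.$$
   Context: All graphs are finite and simple. The join $G=G_1+G_2$ of $G_1=(V_1,E_1)$, $G_2=(V_2,E_2)$ (disjoint) has vertex set $V_1\cup V_2$ and edge set $E_1\cup E_2\cup\{uv:u\in V_1,v\in V_2\}$. The distinguishing index $D'(X)$ is the least $d$ such that $X$ has an edge colouring with $d$ colours preserved by no non-identity automorphism. $G[X]$ is an induced subgraph; $\overline{N_G(v)}=V(G)\setminus N_G(v)$ where $N_G(v)$ is the neighbourhood of $v$. Partition of $V_1$: choose $v_1\in V_1$, set $A:=\overline{N_G(v_1)}$; while some vertex $v$ of $G$ satisfies $\overline{N_G(v)}\cap A\neq\emptyset$ and $\overline{N_G(v)}\not\subseteq A$, replace $A$ by $A\cup\overline{N_G(v)}$; the final set is $A_1$. Choose a vertex of $V_1$ outside $A_1$ and repeat to get $A_2$, etc., giving $V_1=A_1\cup\cdots\cup A_k$; the same procedure gives $V_2=B_1\cup\cdots\cup B_{k'}$. Partition $\{G[A_1],\ldots,G[A_k]\}$ into isomorphism classes $\mathcal{A}_1,\ldots,\mathcal{A}_t$ and $\{G[B_1],\ldots,G[B_{k'}]\}$ into isomorphism classes $\mathcal{B}_1,\ldots,\mathcal{B}_{t'}$. Let $q$ be the number of classes $\mathcal{A}_i$ whose members are isomorphic to the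 members of some $\mathcal{B}_j$, indexed so that for $1\leq i\leq q$ members of $\mathcal{A}_i$ are isomorphic to members of $\mathcal{B}_i$ and no other such isomorphisms occur. Set $\Gamma_i=\mathcal{A}_i\cup\mathcal{B}_i$ for $1\leq i\leq q$, $\Gamma_{q+i}=\mathcal{A}_{q+i}$ for $1\leq i\leq t-q$, and $\Gamma_{t+i}=\mathcal{B}_{q+i}$ for $1\leq i\leq t'-q$. Let $V(\Gamma_i)$ be the union of the vertex sets of the graphs in $\Gamma_i$, and let $\Gamma'_i=G[V(\Gamma_i)]$ (the graphs in $\Gamma_i$ together with all edges of $G$ having both ends in $V(\Gamma_i)$). -}

module Defs where

open import Data.Bool using (Bool; true; false; not; T)
open import Data.Nat using (ℕ; zero; suc; _+_; _⊔_)
open import Data.Fin using (Fin; splitAt; _<_; _≟_)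
open import Data.Fin.Subset using (Subset; _∈_; _∉_; _⊆_; _∩_; _∪_; Nonempty; ⋃)
open import Data.Vec using (tabulate)
open import Data.List using (List; map; filter; _++_; allFin)
open import Data.Sum using (_⊎_; inj₁; inj₂; [_,_])
open import Data.Product using (Σ; ∃; _×_; _,_; proj₁)
open import Data.Empty using (⊥)
open import Relation.Nullary using (¬_)
open import Relation.Binary.PropositionalEquality using (_≡_; refl)
open import Function using (const; _∘_)
open import Function.Bundles using (_↔_; Inverse)

-- Finite simple graphs: a vertex type with a symmetric irreflexive
-- Bool-valued adjacency.  (All vertex types used below are finite:
-- Fin n or subsets of Fin n.)

record Graph (V : Set) : Set where
  field
    adj    : V → V → Bool
    sym    : ∀ u v → adj u v ≡ adj v u
    irrefl : ∀ v → adj v v ≡ false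
open Graph public

Edge : ∀ {V} → Graph V → V → V → Set
Edge G u v = T (adj G u v)

record Iso {V W : Set} (G : Graph V) (H : Graph W) : Set where
  field
    bij  : V ↔ W
    pres : ∀ u v → adj H (Inverse.to bij u) (Inverse.to bij v) ≡ adj G u v

Aut : ∀ {V} → Graph V → Set
Aut G = Iso G G

record EdgeColouring {V : Set} (G : Graph V) (d : ℕ) : Set where
  field
    col    : ∀ u v → Edge G u v → Fin d
    colSym : ∀ u v (e : Edge G u v) (e' : Edge G v u) → col u v e ≡ col v u e'
open EdgeColouring public

Preserves : ∀ {V} {G : Graph V} {d} → Aut G → EdgeColouring G d → Set
Preserves {G = G} φ c =
  ∀ u v (e : Edge G u v) (e' : Edge G (to u) (to v)) → col c (to u) (to v) e' ≡ col c u v e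
  where to = Inverse.to (Iso.bij φ)

Distinguishing : ∀ {V} {G : Graph V} {d} → EdgeColouring G d → Set
Distinguishing {G = G} c =
  ∀ (φ : Aut G) → Preserves φ c → ∀ v → Inverse.to (Iso.bij φ) v ≡ v

DistinguishableWith : ∀ {V} → Graph V → ℕ → Set
DistinguishableWith G d = Σ (EdgeColouring G d) Distinguishing

IsDistIndex : ∀ {V} → Graph V → ℕ → Set
IsDistIndex G d = DistinguishableWith G d × (∀ d' → d' Data.Nat.< d → ¬ DistinguishableWith G d')

-- Join G1 + G2 on vertex set Fin (n1 + n2): the first n1 vertices are V1,
-- the last n2 are V2.

module _ {n1 n2 : ℕ} (G1 : Graph (Fin n1)) (G2 : Graph (Fin n2)) where

  adj⊎ : Fin n1 ⊎ Fin n2 → Fin n1 ⊎ Fin n2 → Bool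
  adj⊎ (inj₁ a) (inj₁ b) = adj G1 a b
  adj⊎ (inj₂ a) (inj₂ b) = adj G2 a b
  adj⊎ (inj₁ a) (inj₂ b) = true
  adj⊎ (inj₂ a) (inj₁ b) = true

  adj⊎-sym : ∀ x y → adj⊎ x y ≡ adj⊎ y x
  adj⊎-sym (inj₁ a) (inj₁ b) = sym G1 a b
  adj⊎-sym (inj₂ a) (inj₂ b) = sym G2 a b
  adj⊎-sym (inj₁ a) (inj₂ b) = refl
  adj⊎-sym (inj₂ a) (inj₁ b) = refl

  adj⊎-irrefl : ∀ x → adj⊎ x x ≡ false
  adj⊎-irrefl (inj₁ a) = irrefl G1 a
  adj⊎-irrefl (inj₂ a) = irrefl G2 a

  join : Graph (Fin (n1 + n2))
  join = record
    { adj    = λ x y → adj⊎ (splitAt n1 x) (splitAt n1 y)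
    ; sym    = λ x y → adj⊎-sym (splitAt n1 x) (splitAt n1 y)
    ; irrefl = λ x → adj⊎-irrefl (splitAt n1 x)
    }

V₁ : (n1 n2 : ℕ) → Subset (n1 + n2)
V₁ n1 n2 = tabulate (λ x → [ const true , const false ] (splitAt n1 x))

V₂ : (n1 n2 : ℕ) → Subset (n1 + n2)
V₂ n1 n2 = tabulate (λ x → [ const false , const true ] (splitAt n1 x))

induced : ∀ {n} → Graph (Fin n) → (S : Subset n) → Graph (Σ (Fin n) (_∈ S))
induced G S = record
  { adj    = λ x y → adj G (proj₁ x) (proj₁ y)
  ; sym    = λ x y → sym G (proj₁ x) (proj₁ y)
  ; irrefl = λ x → irrefl G (proj₁ x)
  }

-- complement of N_G(v) in V(G)  (contains v itself)
nbar : ∀ {n} → Graph (Fin n) → Fin n → Subset n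
nbar G v = tabulate (λ u → not (adj G v u))

-- The partition procedure of the paper.
-- Closes G S A : starting from A := S, the "while" loop can end with A.

data Closes {n} (G : Graph (Fin n)) : Subset n → Subset n → Set where
  stop : ∀ {A} →
         (∀ v → ¬ (Nonempty (nbar G v ∩ A) × ¬ (nbar G v ⊆ A))) →
         Closes G A A
  step : ∀ {A B} v →
         Nonempty (nbar G v ∩ A) → ¬ (nbar G v ⊆ A) →
         Closes G (A ∪ nbar G v) B →
         Closes G A B

-- W = A 0 ∪ ... ∪ A (k-1) is a partition produced by the procedure:
-- seed j ∈ W lies outside the earlier A i, A j is the result of the loop
-- started at the non-neighbourhood of seed j, and the sets cover W.
record ProcPartition {n} (G : Graph (Fin n)) (W : Subset n) {k} (A : Fin k → Subset n) : Set where
  field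
    seed   : Fin k → Fin n
    seed∈W : ∀ j → seed j ∈ W
    fresh  : ∀ j i → i < j → seed j ∉ A i
    closes : ∀ j → Closes G (nbar G (seed j)) (A j)
    covers : ∀ x → x ∈ W → ∃ λ j → x ∈ A j

-- Classes Γ_1, ..., Γ_m (m = t + t' - q): the parts A_j (inj₁ j) and
-- B_j (inj₂ j) are assigned classes in Fin m; every class is used, and two
-- parts get the same class iff their induced subgraphs are isomorphic.

parts : ∀ {n k k'} → (Fin k → Subset n) → (Fin k' → Subset n) → Fin k ⊎ Fin k' → Subset n
parts A B = [ A , B ]

allParts : (k k' : ℕ) → List (Fin k ⊎ Fin k')
allParts k k' = map inj₁ (allFin k) ++ map inj₂ (allFin k')

record IsClassAssignment {n k k' m} (G : Graph (Fin n))
         (P : Fin k ⊎ Fin k' → Subset n) (cls : Fin k ⊎ Fin k' → Fin m) : Set where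
  field
    surj    : ∀ i → ∃ λ p → cls p ≡ i
    sameIso : ∀ p p' → cls p ≡ cls p' → Iso (induced G (P p)) (induced G (P p'))
    isoSame : ∀ p p' → Iso (induced G (P p)) (induced G (P p')) → cls p ≡ cls p'

VΓ : ∀ {n k k' m} → (Fin k ⊎ Fin k' → Subset n) → (Fin k ⊎ Fin k' → Fin m) → Fin m → Subset n
VΓ {k = k} {k'} P cls i = ⋃ (map P (filter (λ p → cls p ≟ i) (allParts k k')))

Γ' : ∀ {n k k' m} → Graph (Fin n) → (P : Fin k ⊎ Fin k' → Subset n) → (cls : Fin k ⊎ Fin k' → Fin m) →
     (i : Fin m) → Graph (Σ (Fin n) (_∈ VΓ P cls i))
Γ' G P cls i = induced G (VΓ P cls i)

maxFin : ∀ {m} → (Fin m → ℕ) → ℕ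
maxFin {zero}  f = 0
maxFin {suc m} f = f Data.Fin.zero ⊔ maxFin (f ∘ Data.Fin.suc)

-- The loop of the partition procedure closes the non-neighbourhood of a seed
-- under non-adjacency, so the parts A_j, B_j are the connected components of
-- the complement of G = G1 + G2.  An automorphism of G therefore maps each part
-- onto an isomorphic part, hence fixes every V(Γ_i) setwise and restricts to an
-- automorphism of Γ'_i.  Colour each edge inside some V(Γ_i) by a distinguishing
-- colouring of Γ'_i and every other edge by one fixed colour: an automorphism
-- preserving this colouring preserves all the colourings of the Γ'_i and is the
-- identity.  So G is distinguishable with max D'(Γ'_i) colours, and as
-- distinguishability is decidable the least such number D'(G) exists below it.

module Submission where

open import Defs hiding (sym)
open import Data.Bool using (true; false; not; T; T?)
import Data.Bool as Bool
open import Data.Bool.Properties using (not-injective)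
open import Data.Empty using (⊥-elim-irr)
open import Data.Fin using (Fin; zero; suc; _≟_; splitAt; inject≤)
open import Data.Fin.Properties using (any?; all?; inject≤-injective)
open import Data.Fin.Subset using (Subset; _∈_; _⊆_; _∪_; ⋃)
open import Data.Fin.Subset.Properties using (_∈?_; ∉⊥; x∈p∩q⁺; x∈p∩q⁻; x∈p∪q⁺; x∈p∪q⁻; p⊆p∪q)
open import Data.List using ([]; _∷_; map; filter; allFin)
import Data.List.Membership.Propositional as Membership
open Membership using (find; lose)
open import Data.List.Membership.Propositional.Properties using (∈-filter⁺; ∈-filter⁻; ∈-map⁺; ∈-++⁺ˡ; ∈-++⁺ʳ; ∈-allFin)
open import Data.List.Relation.Unary.Any using (Any; here; there)
import Data.List.Relation.Unary.Any.Properties as Any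
open import Data.Maybe using (Maybe; just; nothing; is-just; to-witness-T)
import Data.Maybe.Properties as Maybe
open import Data.Nat using (ℕ; zero; suc; _+_; _≤_; _<_; z≤n)
open import Data.Nat.Properties using (≤-refl; ≤-pred; m≤n⇒m≤1+n; m≤n⇒m<n∨m≡n; n≤0⇒n≡0; m≤m⊔n; m≤n⇒m≤o⊔n)
open import Data.Product using (Σ; ∃; _×_; _,_; proj₁; proj₂)
import Data.Product.Properties as Product
open import Data.Sum using (_⊎_; inj₁; inj₂; [_,_]; [_,_]′)
open import Data.Vec using (Vec; []; _∷_; lookup; tabulate)
open import Data.Vec.Properties using (lookup∘tabulate; lookup⇒[]=; []=⇒lookup)
open import Data.Vec.Properties.WithK using ([]=-irrelevant)
open import Function using (_∘_; const; id; case_of_)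
open import Function.Bundles using (Inverse; Equivalence; mk↔ₛ′; _⇔_; mk⇔)
open import Function.Construct.Identity using (↔-id)
open import Function.Construct.Symmetry using (↔-sym)
open import Level using (0ℓ)
open import Relation.Binary.Construct.Closure.ReflexiveTransitive using (Star; ε; _◅_; _◅◅_; gmap; reverse)
open import Relation.Binary.Definitions using (DecidableEquality)
open import Relation.Binary.PropositionalEquality
  using (_≡_; _≢_; refl; sym; trans; cong; cong₂; subst; module ≡-Reasoning)
open import Relation.Nullary using (¬_; Dec; yes; no; contradiction)
open import Relation.Nullary.Decidable using (map′; ¬?; _×-dec_; _⊎-dec_; _→-dec_; decidable-stable)
open import Relation.Unary using (Pred; Decidable)

-- Deciding distinguishability

Searchable : Set → Set₁
Searchable A = ∀ {P : Pred A 0ℓ} → Decidable P → Dec (∃ P)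

search-Maybe : ∀ {A} → Searchable A → Searchable (Maybe A)
search-Maybe search P? =
  map′ [ (nothing ,_) , (λ (a , p) → just a , p) ]′
       (λ { (nothing , p) → inj₁ p ; (just a , p) → inj₂ (a , p) })
       (P? nothing ⊎-dec search (P? ∘ just))

search-Vec : ∀ {A} → Searchable A → ∀ n → Searchable (Vec A n)
search-Vec search zero    P? = map′ ([] ,_) (λ { ([] , p) → p }) (P? [])
search-Vec search (suc n) P? =
  map′ (λ (a , w , p) → a ∷ w , p) (λ { (a ∷ w , p) → a , w , p })
       (search (λ a → search-Vec search n (P? ∘ (a ∷_))))

search-× : ∀ {A B} → Searchable A → Searchable B → Searchable (A × B)
search-× searchA searchB P? =
  map′ (λ (a , b , p) → (a , b) , p) (λ ((a , b) , p) → a , b , p)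
       (searchA (λ a → searchB (λ b → P? (a , b))))

whenT : ∀ {A : Set} b → (T b → A) → Maybe A
whenT true  f = just (f _)
whenT false f = nothing

whenT-just : ∀ {A : Set} {b} (f : T b → A) (t : T b) → whenT b f ≡ just (f t)
whenT-just {b = true} f t = refl

whenT-cong : ∀ {A : Set} {b b′} {f : T b → A} {f′ : T b′ → A} →
             b ≡ b′ → (∀ t t′ → f t ≡ f′ t′) → whenT b f ≡ whenT b′ f′
whenT-cong {b = true}  refl f≡f′ = cong just (f≡f′ _ _)
whenT-cong {b = false} refl f≡f′ = refl

to-witness-T-cong : ∀ {A : Set} {m m′ : Maybe A} (t : T (is-just m)) (t′ : T (is-just m′)) →
                    m ≡ m′ → to-witness-T m t ≡ to-witness-T m′ t′
to-witness-T-cong {m = just x} _ _ refl = refl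

just-to-witness-T : ∀ {A : Set} (m : Maybe A) (t : T (is-just m)) → just (to-witness-T m t) ≡ m
just-to-witness-T (just x) _ = refl

-- Colourings and automorphisms are encoded by finite tables so that they can
-- be searched exhaustively.
module ColourTables {n} (G : Graph (Fin n)) (d : ℕ) where

  ColourTable : Set
  ColourTable = Vec (Vec (Maybe (Fin d)) n) n

  entry : ColourTable → Fin n → Fin n → Maybe (Fin d)
  entry K u v = lookup (lookup K u) v

  IsColouringTable : ColourTable → Set
  IsColouringTable K =
    (∀ u v → Edge G u v → T (is-just (entry K u v))) × (∀ u v → entry K u v ≡ entry K v u)

  Breaks : ColourTable → (Fin n → Fin n) → (Fin n → Fin n) → Set
  Breaks K f f⁻¹ =
    (∀ x → f⁻¹ (f x) ≡ x) × (∀ x → f (f⁻¹ x) ≡ x) ×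
    (∀ u v → adj G (f u) (f v) ≡ adj G u v) ×
    (∀ u v → Edge G u v → entry K (f u) (f v) ≡ entry K u v) ×
    ∃ λ x → f x ≢ x

  PermTables : Set
  PermTables = Vec (Fin n) n × Vec (Fin n) n

  BreaksTables : ColourTable → PermTables → Set
  BreaksTables K (F , F⁻¹) = Breaks K (lookup F) (lookup F⁻¹)

  DistinguishingTable : ColourTable → Set
  DistinguishingTable K = IsColouringTable K × ¬ ∃ (BreaksTables K)

  isColouringTable? : ∀ K → Dec (IsColouringTable K)
  isColouringTable? K =
    all? (λ u → all? (λ v → T? (adj G u v) →-dec T? (is-just (entry K u v))))
    ×-dec all? (λ u → all? (λ v → Maybe.≡-dec _≟_ (entry K u v) (entry K v u)))

  breaks? : ∀ K f f⁻¹ → Dec (Breaks K f f⁻¹)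
  breaks? K f f⁻¹ =
    all? (λ x → f⁻¹ (f x) ≟ x) ×-dec all? (λ x → f (f⁻¹ x) ≟ x)
    ×-dec all? (λ u → all? (λ v → adj G (f u) (f v) Bool.≟ adj G u v))
    ×-dec all? (λ u → all? (λ v →
            T? (adj G u v) →-dec Maybe.≡-dec _≟_ (entry K (f u) (f v)) (entry K u v)))
    ×-dec any? (λ x → ¬? (f x ≟ x))

  distinguishingTable? : Dec (∃ DistinguishingTable)
  distinguishingTable? =
    search-Vec (search-Vec (search-Maybe any?) n) n λ K →
      isColouringTable? K ×-dec
      ¬? (search-× (search-Vec any? n) (search-Vec any? n)
                   (λ FF → breaks? K (lookup (proj₁ FF)) (lookup (proj₂ FF))))

  tableColouring : ∀ K → IsColouringTable K → EdgeColouring G d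
  tableColouring K (defined , symmetric) = record
    { col    = λ u v e → to-witness-T (entry K u v) (defined u v e)
    ; colSym = λ u v e e′ → to-witness-T-cong _ _ (symmetric u v)
    }

  tableColouring-distinguishing : ∀ K (isTable : IsColouringTable K) → ¬ ∃ (BreaksTables K) →
                                  Distinguishing (tableColouring K isTable)
  tableColouring-distinguishing K isTable@(defined , _) unbroken φ preserves x =
    decidable-stable (to x ≟ x) (λ moved → unbroken ((F , F⁻¹) , breaks moved))
    where
    open Inverse (Iso.bij φ)
    open ≡-Reasoning
    F F⁻¹ : Vec (Fin n) n
    F = tabulate to
    F⁻¹ = tabulate from

    entry-preserved : ∀ u v → Edge G u v → entry K (to u) (to v) ≡ entry K u v
    entry-preserved u v e = begin
      entry K (to u) (to v)                                   ≡⟨ just-to-witness-T _ _ ⟨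
      just (col (tableColouring K isTable) (to u) (to v) e′)  ≡⟨ cong just (preserves u v e e′) ⟩
      just (col (tableColouring K isTable) u v e)             ≡⟨ just-to-witness-T _ _ ⟩
      entry K u v                                             ∎
      where
      e′ : Edge G (to u) (to v)
      e′ = subst T (sym (Iso.pres φ u v)) e

    breaks : to x ≢ x → BreaksTables K (F , F⁻¹)
    breaks moved =
      (λ y → trans (cong (lookup F⁻¹) (lookup∘tabulate to y))
                   (trans (lookup∘tabulate from (to y)) (strictlyInverseʳ y))) ,
      (λ y → trans (cong (lookup F) (lookup∘tabulate from y))
                   (trans (lookup∘tabulate to (from y)) (strictlyInverseˡ y))) ,
      (λ u v → trans (cong₂ (adj G) (lookup∘tabulate to u) (lookup∘tabulate to v)) (Iso.pres φ u v)) ,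
      (λ u v e → trans (cong₂ (entry K) (lookup∘tabulate to u) (lookup∘tabulate to v))
                       (entry-preserved u v e)) ,
      x , moved ∘ trans (sym (lookup∘tabulate to x))

  colouringTable : EdgeColouring G d → ColourTable
  colouringTable c = tabulate λ u → tabulate λ v → whenT (adj G u v) (col c u v)

  entry-colouringTable : ∀ c u v → entry (colouringTable c) u v ≡ whenT (adj G u v) (col c u v)
  entry-colouringTable c u v =
    trans (cong (λ row → lookup row v) (lookup∘tabulate _ u)) (lookup∘tabulate _ v)

  colouringTable-isColouringTable : ∀ c → IsColouringTable (colouringTable c)
  colouringTable-isColouringTable c =
    (λ u v e → subst (T ∘ is-just) (sym (trans (entry-colouringTable c u v) (whenT-just _ e))) _) ,
    (λ u v → trans (entry-colouringTable c u v)
             (trans (whenT-cong (Graph.sym G u v) (colSym c u v)) (sym (entry-colouringTable c v u))))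

  colouringTable-unbroken : ∀ c → Distinguishing c → ¬ ∃ (BreaksTables (colouringTable c))
  colouringTable-unbroken c distinguishing ((F , F⁻¹) , inverseʳ , inverseˡ , pres , keeps , x , moved) =
    moved (distinguishing φ preserves x)
    where
    open ≡-Reasoning
    f : Fin n → Fin n
    f = lookup F
    K : ColourTable
    K = colouringTable c
    φ : Aut G
    φ = record { bij = mk↔ₛ′ f (lookup F⁻¹) inverseˡ inverseʳ ; pres = pres }
    preserves : Preserves φ c
    preserves u v e e′ = Maybe.just-injective (begin
      just (col c (f u) (f v) e′)                    ≡⟨ whenT-just _ e′ ⟨
      whenT (adj G (f u) (f v)) (col c (f u) (f v))  ≡⟨ entry-colouringTable c (f u) (f v) ⟨
      entry K (f u) (f v)                            ≡⟨ keeps u v e ⟩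
      entry K u v                                    ≡⟨ entry-colouringTable c u v ⟩
      whenT (adj G u v) (col c u v)                  ≡⟨ whenT-just _ e ⟩
      just (col c u v e)                             ∎)

distinguishableWith? : ∀ {n} (G : Graph (Fin n)) d → Dec (DistinguishableWith G d)
distinguishableWith? G d =
  map′ (λ (K , isTable , unbroken) → tableColouring K isTable , tableColouring-distinguishing K isTable unbroken)
       (λ (c , distinguishing) → colouringTable c , colouringTable-isColouringTable c ,
                                 colouringTable-unbroken c distinguishing)
       distinguishingTable?
  where open ColourTables G d

Minimal : (ℕ → Set) → ℕ → Set
Minimal Q d = Q d × (∀ d′ → d′ < d → ¬ Q d′)

minimal-≤? : ∀ {Q : Pred ℕ 0ℓ} → Decidable Q → ∀ r → (∃ λ d → Minimal Q d × d ≤ r) ⊎ (∀ d → d ≤ r → ¬ Q d)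
minimal-≤? Q? zero with Q? zero
... | yes q  = inj₁ (zero , (q , λ _ ()) , z≤n)
... | no ¬q = inj₂ λ { zero z≤n → ¬q }
minimal-≤? Q? (suc r) with minimal-≤? Q? r | Q? (suc r)
... | inj₁ (d , minimal , d≤r) | _ = inj₁ (d , minimal , m≤n⇒m≤1+n d≤r)
... | inj₂ none | yes q  = inj₁ (suc r , (q , λ d d<1+r → none d (≤-pred d<1+r)) , ≤-refl)
... | inj₂ none | no ¬q = inj₂ λ d d≤1+r →
  [ (λ d<1+r → none d (≤-pred d<1+r)) , (λ { refl → ¬q }) ]′ (m≤n⇒m<n∨m≡n d≤1+r)

minimal-≤ : ∀ {Q : Pred ℕ 0ℓ} → Decidable Q → ∀ {r} → Q r → ∃ λ d → Minimal Q d × d ≤ r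
minimal-≤ Q? {r} q = [ id , (λ none → contradiction q (none r ≤-refl)) ]′ (minimal-≤? Q? r)

≤-maxFin : ∀ {m} (f : Fin m → ℕ) i → f i ≤ maxFin f
≤-maxFin f zero    = m≤m⊔n _ _
≤-maxFin f (suc i) = m≤n⇒m≤o⊔n (f zero) (≤-maxFin (f ∘ suc) i)

maxFin≡0 : ∀ {m} (f : Fin m → ℕ) → maxFin f ≡ 0 → ∀ i → f i ≡ 0
maxFin≡0 f max≡0 i = n≤0⇒n≡0 (subst (f i ≤_) max≡0 (≤-maxFin f i))

-- Automorphisms and induced subgraphs

module _ {A : Set} (_≟ᴬ_ : DecidableEquality A) (x y : A) where

  transpose : A → A
  transpose z with z ≟ᴬ x | z ≟ᴬ y
  ... | yes _ | _     = y
  ... | no _  | yes _ = x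
  ... | no _  | no _  = z

  transpose-x : transpose x ≡ y
  transpose-x with x ≟ᴬ x | x ≟ᴬ y
  ... | yes _  | _ = refl
  ... | no x≢x | _ = contradiction refl x≢x

  transpose-y : transpose y ≡ x
  transpose-y with y ≟ᴬ x | y ≟ᴬ y
  ... | yes y≡x | _      = y≡x
  ... | no _    | yes _  = refl
  ... | no _    | no y≢y = contradiction refl y≢y

  transpose-other : ∀ {z} → z ≢ x → z ≢ y → transpose z ≡ z
  transpose-other {z} z≢x z≢y with z ≟ᴬ x | z ≟ᴬ y
  ... | yes z≡x | _       = contradiction z≡x z≢x
  ... | no _    | yes z≡y = contradiction z≡y z≢y
  ... | no _    | no _    = refl

  transpose-involutive : ∀ z → transpose (transpose z) ≡ z
  transpose-involutive z = by-cases (z ≟ᴬ x) (z ≟ᴬ y)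
    where
    by-cases : Dec (z ≡ x) → Dec (z ≡ y) → transpose (transpose z) ≡ z
    by-cases (yes z≡x) _ =
      trans (cong (transpose ∘ transpose) z≡x) (trans (cong transpose transpose-x) (trans transpose-y (sym z≡x)))
    by-cases (no _) (yes z≡y) =
      trans (cong (transpose ∘ transpose) z≡y) (trans (cong transpose transpose-y) (trans transpose-x (sym z≡y)))
    by-cases (no z≢x) (no z≢y) =
      trans (cong transpose (transpose-other z≢x z≢y)) (transpose-other z≢x z≢y)

Aut-inverse : ∀ {V} {G : Graph V} → Aut G → Aut G
Aut-inverse {G = G} φ = record
  { bij  = ↔-sym (Iso.bij φ)
  ; pres = λ a b → trans (sym (Iso.pres φ (from a) (from b)))
                         (cong₂ (adj G) (strictlyInverseˡ a) (strictlyInverseˡ b))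
  }
  where open Inverse (Iso.bij φ)

no-edges : ∀ {V} {H : Graph V} → EdgeColouring H 0 → ∀ a b → adj H a b ≡ false
no-edges {H = H} c a b with adj H a b in a~b
... | false = refl
... | true  with () ← col c a b (subst T (sym a~b) _)

-- A 0-colouring forces the graph to be edgeless, so the transposition of
-- any two vertices is an automorphism preserving it.
zero-colours⇒subsingleton : ∀ {V} {H : Graph V} → DecidableEquality V →
                            DistinguishableWith H 0 → ∀ x y → x ≡ y
zero-colours⇒subsingleton {H = H} _≟ᴬ_ (c , distinguishing) x y =
  trans (sym (distinguishing τ (λ u v e _ → case col c u v e of λ ()) x)) (transpose-x _≟ᴬ_ x y)
  where
  τ : Aut H
  τ = record
    { bij  = mk↔ₛ′ (transpose _≟ᴬ_ x y) (transpose _≟ᴬ_ x y)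
                   (transpose-involutive _≟ᴬ_ x y) (transpose-involutive _≟ᴬ_ x y)
    ; pres = λ a b → trans (no-edges c _ _) (sym (no-edges c a b))
    }

≡-member : ∀ {n} {S : Subset n} {x y} {x∈S : x ∈ S} {y∈S : y ∈ S} →
           x ≡ y → _≡_ {A = Σ (Fin n) (_∈ S)} (x , x∈S) (y , y∈S)
≡-member refl = cong (_ ,_) ([]=-irrelevant _ _)

member-≟ : ∀ {n} {S : Subset n} → DecidableEquality (Σ (Fin n) (_∈ S))
member-≟ = Product.≡-dec _≟_ (λ x∈S x∈S′ → yes ([]=-irrelevant x∈S x∈S′))

module _ {n} {G : Graph (Fin n)} where

  inducedIso : ∀ {S T : Subset n} (f g : Fin n → Fin n) →
               (∀ {x} → x ∈ S → f x ∈ T) → (∀ {y} → y ∈ T → g y ∈ S) →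
               (∀ {x} → x ∈ S → g (f x) ≡ x) → (∀ {y} → y ∈ T → f (g y) ≡ y) →
               (∀ {a b} → a ∈ S → b ∈ S → adj G (f a) (f b) ≡ adj G a b) →
               Iso (induced G S) (induced G T)
  inducedIso f g f∈ g∈ gf fg pres = record
    { bij  = mk↔ₛ′ (λ (x , x∈S) → f x , f∈ x∈S) (λ (y , y∈T) → g y , g∈ y∈T)
                   (λ (y , y∈T) → ≡-member (fg y∈T)) (λ (x , x∈S) → ≡-member (gf x∈S))
    ; pres = λ (a , a∈S) (b , b∈S) → pres a∈S b∈S
    }

  Aut-restrict : ∀ {S T : Subset n} (φ : Aut G) →
                 (∀ {x} → x ∈ S → Inverse.to (Iso.bij φ) x ∈ T) →
                 (∀ {y} → y ∈ T → Inverse.from (Iso.bij φ) y ∈ S) →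
                 Iso (induced G S) (induced G T)
  Aut-restrict φ to∈ from∈ =
    inducedIso to from to∈ from∈ (λ {x} _ → strictlyInverseʳ x) (λ {y} _ → strictlyInverseˡ y)
               (λ {a} {b} _ _ → Iso.pres φ a b)
    where open Inverse (Iso.bij φ)

  subsingleton-Iso : ∀ {S T : Subset n} →
                     (∀ {a b} → a ∈ S → b ∈ S → a ≡ b) → (∀ {a b} → a ∈ T → b ∈ T → a ≡ b) →
                     ∀ {x y} → x ∈ S → y ∈ T → Iso (induced G S) (induced G T)
  subsingleton-Iso S-sub T-sub {x} {y} x∈S y∈T =
    inducedIso (const y) (const x) (const y∈T) (const x∈S)
               (S-sub x∈S) (T-sub y∈T)
               (λ a∈S b∈S → trans (irrefl G y)
                 (sym (trans (cong₂ (adj G) (S-sub a∈S x∈S) (S-sub b∈S x∈S)) (irrefl G x))))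

-- Components of the complement and the partition procedure

module _ {n} (G : Graph (Fin n)) where

  NonAdj : Fin n → Fin n → Set
  NonAdj u v = adj G u v ≡ false

  NonAdj-sym : ∀ {u v} → NonAdj u v → NonAdj v u
  NonAdj-sym {u} {v} = trans (Graph.sym G v u)

  CoReach : Fin n → Fin n → Set
  CoReach = Star NonAdj

  CoReach-sym : ∀ {u v} → CoReach u v → CoReach v u
  CoReach-sym = reverse NonAdj-sym

  CoReach-map : (f : Fin n → Fin n) → (∀ a b → adj G (f a) (f b) ≡ adj G a b) →
                ∀ {u v} → CoReach u v → CoReach (f u) (f v)
  CoReach-map f pres = gmap f (λ {a} {b} → trans (pres a b))

  ∈nbar⁺ : ∀ {u v} → NonAdj u v → v ∈ nbar G u
  ∈nbar⁺ {u} {v} u≁v = lookup⇒[]= v _ (trans (lookup∘tabulate _ v) (cong not u≁v))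

  ∈nbar⁻ : ∀ {u v} → v ∈ nbar G u → NonAdj u v
  ∈nbar⁻ {u} {v} v∈ = not-injective (trans (sym (lookup∘tabulate _ v)) ([]=⇒lookup v∈))

  Closes-⊆ : ∀ {S A} → Closes G S A → S ⊆ A
  Closes-⊆ (stop _)            x∈S = x∈S
  Closes-⊆ (step v _ _ closes) x∈S = Closes-⊆ closes (p⊆p∪q (nbar G v) x∈S)

  Closes-closed : ∀ {S A} → Closes G S A → ∀ {u w} → u ∈ A → CoReach u w → w ∈ A
  Closes-closed closes            u∈A ε                = u∈A
  Closes-closed closes@(stop stable) {u} u∈A (_◅_ {j = w} u≁w reach) =
    Closes-closed closes (decidable-stable (w ∈? _) λ w∉A →
      stable u ((u , x∈p∩q⁺ (∈nbar⁺ (irrefl G u) , u∈A)) , λ nbar⊆A → w∉A (nbar⊆A (∈nbar⁺ u≁w))))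
      reach
  Closes-closed (step _ _ _ closes) u∈A reach = Closes-closed closes u∈A reach

  Closes-reach : ∀ {s S A} → (∀ {y} → y ∈ S → CoReach s y) → Closes G S A →
                 ∀ {y} → y ∈ A → CoReach s y
  Closes-reach reach (stop _) = reach
  Closes-reach {s} {S} reach (step v (x , x∈nbar∩S) _ closes) = Closes-reach reach′ closes
    where
    reach′ : ∀ {y} → y ∈ S ∪ nbar G v → CoReach s y
    reach′ y∈ with x∈p∪q⁻ S (nbar G v) y∈
    ... | inj₁ y∈S    = reach y∈S
    ... | inj₂ y∈nbar =
      let x∈nbar , x∈S = x∈p∩q⁻ (nbar G v) S x∈nbar∩S
      in reach x∈S ◅◅ NonAdj-sym (∈nbar⁻ x∈nbar) ◅ ∈nbar⁻ y∈nbar ◅ ε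

  Closes-nbar⇔CoReach : ∀ {s A} → Closes G (nbar G s) A → ∀ {y} → y ∈ A ⇔ CoReach s y
  Closes-nbar⇔CoReach {s} closes = mk⇔
    (Closes-reach (λ y∈ → ∈nbar⁻ y∈ ◅ ε) closes)
    (Closes-closed closes (Closes-⊆ closes (∈nbar⁺ (irrefl G s))))

module Parts {n} (G : Graph (Fin n)) {I : Set} (P : I → Subset n) (seed : I → Fin n)
             (closes : ∀ p → Closes G (nbar G (seed p)) (P p)) where

  part-connected : ∀ {p x y} → x ∈ P p → y ∈ P p → CoReach G x y
  part-connected {p} x∈ y∈ =
    CoReach-sym G (Equivalence.to (Closes-nbar⇔CoReach G (closes p)) x∈)
    ◅◅ Equivalence.to (Closes-nbar⇔CoReach G (closes p)) y∈

  part-closed : ∀ {p x y} → x ∈ P p → CoReach G x y → y ∈ P p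
  part-closed {p} = Closes-closed G (closes p)

  part-image : (f : Fin n → Fin n) → (∀ a b → adj G (f a) (f b) ≡ adj G a b) →
               ∀ {p q x y} → x ∈ P p → y ∈ P p → f x ∈ P q → f y ∈ P q
  part-image f pres x∈ y∈ fx∈ = part-closed fx∈ (CoReach-map G f pres (part-connected x∈ y∈))

  Aut-part-Iso : (φ : Aut G) → ∀ {p q x} → x ∈ P p → Inverse.to (Iso.bij φ) x ∈ P q →
                 Iso (induced G (P p)) (induced G (P q))
  Aut-part-Iso φ {p} {q} {x} x∈ φx∈ =
    Aut-restrict φ (λ y∈ → part-image to (Iso.pres φ) x∈ y∈ φx∈)
                   (λ z∈ → part-image from (Iso.pres (Aut-inverse φ)) φx∈ z∈
                             (subst (_∈ P p) (sym (strictlyInverseʳ x)) x∈))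
    where open Inverse (Iso.bij φ)

  overlap-Iso : ∀ {p q x} → x ∈ P p → x ∈ P q → Iso (induced G (P p)) (induced G (P q))
  overlap-Iso = Aut-part-Iso (record { bij = ↔-id _ ; pres = λ _ _ → refl })

-- The classes Γ_i and the combined colouring

x∈⋃⁻ : ∀ {n} {x : Fin n} Ss → x ∈ ⋃ Ss → Any (x ∈_) Ss
x∈⋃⁻ []       x∈ = contradiction x∈ ∉⊥
x∈⋃⁻ (S ∷ Ss) x∈ = [ here , there ∘ x∈⋃⁻ Ss ]′ (x∈p∪q⁻ S (⋃ Ss) x∈)

x∈⋃⁺ : ∀ {n} {x : Fin n} {Ss} → Any (x ∈_) Ss → x ∈ ⋃ Ss
x∈⋃⁺ (here x∈S)   = x∈p∪q⁺ (inj₁ x∈S)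
x∈⋃⁺ (there x∈Ss) = x∈p∪q⁺ (inj₂ (x∈⋃⁺ x∈Ss))

∈-allParts : ∀ {k k′} p → p Membership.∈ allParts k k′
∈-allParts         (inj₁ a) = ∈-++⁺ˡ (∈-map⁺ inj₁ (∈-allFin a))
∈-allParts {k = k} (inj₂ b) = ∈-++⁺ʳ (map inj₁ (allFin k)) (∈-map⁺ inj₂ (∈-allFin b))

∈VΓ⇔ : ∀ {n k k′ m} {P : Fin k ⊎ Fin k′ → Subset n} {cls : Fin k ⊎ Fin k′ → Fin m} {i x} →
       x ∈ VΓ P cls i ⇔ ∃ λ p → cls p ≡ i × x ∈ P p
∈VΓ⇔ {n} {k} {k′} {P = P} {cls} {i} {x} = mk⇔ to from
  where
  ofClass? : ∀ p → Dec (cls p ≡ i)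
  ofClass? p = cls p ≟ i

  to : x ∈ VΓ P cls i → ∃ λ p → cls p ≡ i × x ∈ P p
  to x∈ = let p , p∈ , x∈P = find (Any.map⁻ (x∈⋃⁻ (map P (filter ofClass? (allParts k k′))) x∈))
          in p , proj₂ (∈-filter⁻ ofClass? {xs = allParts k k′} p∈) , x∈P

  from : (∃ λ p → cls p ≡ i × x ∈ P p) → x ∈ VΓ P cls i
  from (p , cls≡i , x∈P) = x∈⋃⁺ (Any.map⁺ (lose (∈-filter⁺ ofClass? (∈-allParts p) cls≡i) x∈P))

module Classes {n k k′ m} (G : Graph (Fin n)) (P : Fin k ⊎ Fin k′ → Subset n)
               (seed : Fin k ⊎ Fin k′ → Fin n) (closes : ∀ p → Closes G (nbar G (seed p)) (P p))
               (cover : ∀ x → ∃ λ p → x ∈ P p)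
               (cls : Fin k ⊎ Fin k′ → Fin m) (classes : IsClassAssignment G P cls) where

  open Parts G P seed closes
  open IsClassAssignment classes

  class : Fin n → Fin m
  class x = cls (proj₁ (cover x))

  ∈VΓ⇔class≡ : ∀ {i x} → x ∈ VΓ P cls i ⇔ class x ≡ i
  ∈VΓ⇔class≡ {i} {x} = mk⇔
    (λ x∈ → let p , cls≡i , x∈P = Equivalence.to ∈VΓ⇔ x∈
            in trans (isoSame _ p (overlap-Iso (proj₂ (cover x)) x∈P)) cls≡i)
    (λ class≡i → Equivalence.from ∈VΓ⇔ (proj₁ (cover x) , class≡i , proj₂ (cover x)))

  Aut-class : (φ : Aut G) → ∀ x → class (Inverse.to (Iso.bij φ) x) ≡ class x
  Aut-class φ x = sym (isoSame _ _ (Aut-part-Iso φ (proj₂ (cover x)) (proj₂ (cover _))))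

  Aut-VΓ : (φ : Aut G) → ∀ {i x} → x ∈ VΓ P cls i → Inverse.to (Iso.bij φ) x ∈ VΓ P cls i
  Aut-VΓ φ {x = x} x∈ = Equivalence.from ∈VΓ⇔class≡
    (trans (Aut-class φ x) (Equivalence.to ∈VΓ⇔class≡ x∈))

someColour : ∀ D → .(D ≢ 0) → Fin D
someColour zero    D≢0 = ⊥-elim-irr (D≢0 refl)
someColour (suc _) _   = zero

module ClassColouring {n k k′ m} (G : Graph (Fin n)) (P : Fin k ⊎ Fin k′ → Subset n)
         (seed : Fin k ⊎ Fin k′ → Fin n) (closes : ∀ p → Closes G (nbar G (seed p)) (P p))
         (cover : ∀ x → ∃ λ p → x ∈ P p)
         (cls : Fin k ⊎ Fin k′ → Fin m) (classes : IsClassAssignment G P cls)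
         (ds : Fin m → ℕ) (distinguishable : ∀ i → DistinguishableWith (Γ' G P cls i) (ds i)) where

  open Classes G P seed closes cover cls classes
  open IsClassAssignment classes

  D : ℕ
  D = maxFin ds

  c : ∀ i → EdgeColouring (Γ' G P cls i) (ds i)
  c i = proj₁ (distinguishable i)

  lift : ∀ i → Fin (ds i) → Fin D
  lift i a = inject≤ a (≤-maxFin ds i)

  lift-injective : ∀ i {a b} → lift i a ≡ lift i b → a ≡ b
  lift-injective i = inject≤-injective _ _ _ _

  -- Edges between distinct classes need some colour in Fin D.  There is one,
  -- since for D = 0 every Γ'_i is a single vertex, so all parts are isomorphic
  -- and there is only one class.
  D≡0⇒class≡ : D ≡ 0 → ∀ u v → class u ≡ class v
  D≡0⇒class≡ D≡0 u v =
    isoSame _ _ (subsingleton-Iso part-subsingleton part-subsingleton (proj₂ (cover u)) (proj₂ (cover v)))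
    where
    part-subsingleton : ∀ {p a b} → a ∈ P p → b ∈ P p → a ≡ b
    part-subsingleton {p} a∈ b∈ =
      cong proj₁ (zero-colours⇒subsingleton member-≟
        (subst (DistinguishableWith (Γ' G P cls (cls p))) (maxFin≡0 ds D≡0 (cls p)) (distinguishable (cls p)))
        (_ , Equivalence.from ∈VΓ⇔ (p , refl , a∈)) (_ , Equivalence.from ∈VΓ⇔ (p , refl , b∈)))

  colourBetween : ∀ {u v} i j → u ∈ VΓ P cls i → v ∈ VΓ P cls j → Edge G u v → Fin D
  colourBetween i j u∈ v∈ e with i ≟ j
  ... | yes refl = lift i (col (c i) (_ , u∈) (_ , v∈) e)
  ... | no i≢j   = someColour D λ D≡0 → i≢j
    (trans (sym (Equivalence.to ∈VΓ⇔class≡ u∈)) (trans (D≡0⇒class≡ D≡0 _ _) (Equivalence.to ∈VΓ⇔class≡ v∈)))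

  colourBetween-sym : ∀ {u v} i j (u∈ : u ∈ VΓ P cls i) (v∈ : v ∈ VΓ P cls j) e e′ →
                      colourBetween i j u∈ v∈ e ≡ colourBetween j i v∈ u∈ e′
  colourBetween-sym i j u∈ v∈ e e′ with i ≟ j | j ≟ i
  ... | yes refl | yes refl = cong (lift i) (colSym (c i) _ _ e e′)
  ... | yes refl | no i≢i   = contradiction refl i≢i
  ... | no i≢i   | yes refl = contradiction refl i≢i
  ... | no _     | no _     = refl

  colourBetween-diag : ∀ {u v} i (u∈ : u ∈ VΓ P cls i) (v∈ : v ∈ VΓ P cls i) e →
                       colourBetween i i u∈ v∈ e ≡ lift i (col (c i) (_ , u∈) (_ , v∈) e)
  colourBetween-diag i u∈ v∈ e with i ≟ i
  ... | yes refl = refl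
  ... | no i≢i   = contradiction refl i≢i

  colourBetween-cong : ∀ {u v i i′ j j′} {u∈ : u ∈ VΓ P cls i} {u∈′ : u ∈ VΓ P cls i′}
                       {v∈ : v ∈ VΓ P cls j} {v∈′ : v ∈ VΓ P cls j′} {e} →
                       i ≡ i′ → j ≡ j′ → colourBetween i j u∈ v∈ e ≡ colourBetween i′ j′ u∈′ v∈′ e
  colourBetween-cong {i = i} {j = j} {e = e} refl refl =
    cong₂ (λ u∈ v∈ → colourBetween i j u∈ v∈ e) ([]=-irrelevant _ _) ([]=-irrelevant _ _)

  colouring : EdgeColouring G D
  colouring = record
    { col    = λ u v → colourBetween (class u) (class v) (member u) (member v)
    ; colSym = λ u v → colourBetween-sym (class u) (class v) (member u) (member v)
    }
    where
    member : ∀ x → x ∈ VΓ P cls (class x)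
    member x = Equivalence.from ∈VΓ⇔class≡ refl

  colouring-within : ∀ {u v i} (u∈ : u ∈ VΓ P cls i) (v∈ : v ∈ VΓ P cls i) e →
                     col colouring u v e ≡ lift i (col (c i) (u , u∈) (v , v∈) e)
  colouring-within {i = i} u∈ v∈ e =
    trans (colourBetween-cong (Equivalence.to ∈VΓ⇔class≡ u∈) (Equivalence.to ∈VΓ⇔class≡ v∈))
          (colourBetween-diag i u∈ v∈ e)

  colouring-distinguishing : Distinguishing colouring
  colouring-distinguishing φ preserves x =
    cong proj₁ (proj₂ (distinguishable (class x)) ψ ψ-preserves (x , Equivalence.from ∈VΓ⇔class≡ refl))
    where
    ψ : Aut (Γ' G P cls (class x))
    ψ = Aut-restrict φ (Aut-VΓ φ) (Aut-VΓ (Aut-inverse φ))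
    ψ-preserves : Preserves ψ (c (class x))
    ψ-preserves (a , a∈) (b , b∈) e e′ = lift-injective (class x)
      (trans (sym (colouring-within (Aut-VΓ φ a∈) (Aut-VΓ φ b∈) e′))
             (trans (preserves a b e e′) (colouring-within a∈ b∈ e)))

distinguishableWith-maxFin :
  ∀ {n k k′ m} (G : Graph (Fin n)) (P : Fin k ⊎ Fin k′ → Subset n)
  (seed : Fin k ⊎ Fin k′ → Fin n) → (∀ p → Closes G (nbar G (seed p)) (P p)) →
  (∀ x → ∃ λ p → x ∈ P p) →
  (cls : Fin k ⊎ Fin k′ → Fin m) → IsClassAssignment G P cls →
  (ds : Fin m → ℕ) → (∀ i → DistinguishableWith (Γ' G P cls i) (ds i)) →
  DistinguishableWith G (maxFin ds)
distinguishableWith-maxFin G P seed closes cover cls classes ds distinguishable =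
  colouring , colouring-distinguishing
  where open ClassColouring G P seed closes cover cls classes ds distinguishable

V₁-or-V₂ : ∀ n1 n2 (x : Fin (n1 + n2)) → x ∈ V₁ n1 n2 ⊎ x ∈ V₂ n1 n2
V₁-or-V₂ n1 n2 x with splitAt n1 x in eq
... | inj₁ _ = inj₁ (lookup⇒[]= x _ (trans (lookup∘tabulate _ x) (cong [ const true , const false ] eq)))
... | inj₂ _ = inj₂ (lookup⇒[]= x _ (trans (lookup∘tabulate _ x) (cong [ const false , const true ] eq)))

join-cover : ∀ {n1 n2} (G1 : Graph (Fin n1)) (G2 : Graph (Fin n2)) {k k′}
             {A : Fin k → Subset (n1 + n2)} {B : Fin k′ → Subset (n1 + n2)} →
             ProcPartition (join G1 G2) (V₁ n1 n2) A → ProcPartition (join G1 G2) (V₂ n1 n2) B →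
             ∀ x → ∃ λ p → x ∈ parts A B p
join-cover {n1} {n2} _ _ PA PB x with V₁-or-V₂ n1 n2 x
... | inj₁ x∈V₁ = let j , x∈ = ProcPartition.covers PA x x∈V₁ in inj₁ j , x∈
... | inj₂ x∈V₂ = let j , x∈ = ProcPartition.covers PB x x∈V₂ in inj₂ j , x∈

theorem3p7 : ∀ {n1 n2} (G1 : Graph (Fin n1)) (G2 : Graph (Fin n2))
    {k k'} (A : Fin k → Subset (n1 + n2)) (B : Fin k' → Subset (n1 + n2)) →
    ProcPartition (join G1 G2) (V₁ n1 n2) A →
    ProcPartition (join G1 G2) (V₂ n1 n2) B →
    ∀ {m} (cls : Fin k ⊎ Fin k' → Fin m) →
    IsClassAssignment (join G1 G2) (parts A B) cls →
    (ds : Fin m → ℕ) →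
    (∀ i → IsDistIndex (Γ' (join G1 G2) (parts A B) cls i) (ds i)) →
    ∃ λ d → IsDistIndex (join G1 G2) d × d ≤ maxFin ds
theorem3p7 G1 G2 A B PA PB cls classes ds distIndex =
  minimal-≤ (distinguishableWith? (join G1 G2))
    (distinguishableWith-maxFin (join G1 G2) (parts A B)
       [ ProcPartition.seed PA , ProcPartition.seed PB ]
       [ ProcPartition.closes PA , ProcPartition.closes PB ]
       (join-cover G1 G2 PA PB) cls classes ds (proj₁ ∘ distIndex))
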